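{- Let $L$ be a normal modal logic and let $X$ be a set of constant formulas (formulas containing no propositional variables). If $L$ enjoys the uniform Lyndon interpolation property, then $L+X$ also enjoys the uniform Lyndon interpolation property.
   Context: Formulas are built from countably many propositional variables, $\bot$, $\to$, $\Box$. Positive/negative variable sets: $v^+(p)=\{p\}$, $v^-(p)=\emptyset$; $v^\pm(\bot)=\emptyset$; $v^+(\psi\to\theta)=v^-(\psi)\cup v^+(\theta)$, $v^-(\psi\to\theta)=v^+(\psi)\cup v^-(\theta)$; $v^\pm(\Box\psi)=v^\pm(\psi)$. A normal logic is a set of formulas containing all tautologies and $\Box(p\to q)\to(\Box p\to\Box q)$, closed under modus ponens, necessitation and uniform substitution; $L\vdash\varphi$ means $\varphi\in L$. $L+X$ is the least normal logic containing $L\cup X$. $L$ has the uniform Lyndon interpolation property if for every formula $\varphi$ and finite sets $P,Q$ of variables there is $\theta$ with $v^+(\theta)\subseteq v^+(\varphi)\setminus P$, $v^-(\theta)\subseteq v^-(\varphi)\setminus Q$, $L\vdash\varphi\to\theta$, and $L\vdash\theta\to\psi$ for every $\psi$ with $v^+(\psi)\cap P=v^-(\psi)\cap Q=\emptyset$ and $L\vdash\varphi\to\psi$. -}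

module Defs where

open import Data.Nat using (ℕ)
open import Data.Bool using (Bool; true; false; not; _∨_)
open import Data.List using (List; []; _∷_; _++_)
open import Data.List.Membership.Propositional using (_∈_; _∉_)
open import Data.Product using (_×_; Σ; _,_)
open import Relation.Binary.PropositionalEquality using (_≡_)

data Fm : Set where
  var : ℕ → Fm
  ⊥' : Fm
  _⇒_ : Fm → Fm → Fm
  □ : Fm → Fm

infixr 5 _⇒_

mutual
  v⁺ : Fm → List ℕ
  v⁺ (var p) = p ∷ []
  v⁺ ⊥' = []
  v⁺ (ψ ⇒ θ) = v⁻ ψ ++ v⁺ θ
  v⁺ (□ ψ) = v⁺ ψ

  v⁻ : Fm → List ℕ
  v⁻ (var p) = []
  v⁻ ⊥' = []
  v⁻ (ψ ⇒ θ) = v⁺ ψ ++ v⁻ θ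
  v⁻ (□ ψ) = v⁻ ψ

data Constant : Fm → Set where
  c⊥ : Constant ⊥'
  c⇒ : ∀ {ψ θ} → Constant ψ → Constant θ → Constant (ψ ⇒ θ)
  c□ : ∀ {ψ} → Constant ψ → Constant (□ ψ)

_⟶ᵇ_ : Bool → Bool → Bool
a ⟶ᵇ b = not a ∨ b

eval : (ℕ → Bool) → (Fm → Bool) → Fm → Bool
eval v b (var p) = v p
eval v b ⊥' = false
eval v b (ψ ⇒ θ) = eval v b ψ ⟶ᵇ eval v b θ
eval v b (□ ψ) = b ψ

-- propositional tautology (substitution instance of a classical tautology)
Tautology : Fm → Set
Tautology φ = (v : ℕ → Bool) (b : Fm → Bool) → eval v b φ ≡ true

sub : (ℕ → Fm) → Fm → Fm
sub σ (var p) = σ p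
sub σ ⊥' = ⊥'
sub σ (ψ ⇒ θ) = sub σ ψ ⇒ sub σ θ
sub σ (□ ψ) = □ (sub σ ψ)

Logic : Set₁
Logic = Fm → Set

Kax : Fm
Kax = □ (var 0 ⇒ var 1) ⇒ (□ (var 0) ⇒ □ (var 1))

record Normal (L : Logic) : Set where
  field
    taut : ∀ φ → Tautology φ → L φ
    K    : L Kax
    MP   : ∀ φ ψ → L (φ ⇒ ψ) → L φ → L ψ
    Nec  : ∀ φ → L φ → L (□ φ)
    US   : ∀ σ φ → L φ → L (sub σ φ)

-- L + X : the least normal logic containing L ∪ X (inductive closure)
data _⊕_ (L X : Logic) : Logic where
  inL  : ∀ {φ} → L φ → (L ⊕ X) φ
  inX  : ∀ {φ} → X φ → (L ⊕ X) φ
  taut : ∀ {φ} → Tautology φ → (L ⊕ X) φ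
  K    : (L ⊕ X) Kax
  MP   : ∀ {φ ψ} → (L ⊕ X) (φ ⇒ ψ) → (L ⊕ X) φ → (L ⊕ X) ψ
  Nec  : ∀ {φ} → (L ⊕ X) φ → (L ⊕ X) (□ φ)
  US   : ∀ {φ} (σ : ℕ → Fm) → (L ⊕ X) φ → (L ⊕ X) (sub σ φ)

ULIP : Logic → Set
ULIP L =
  (φ : Fm) (P Q : List ℕ) →
  Σ Fm λ θ →
    (∀ p → p ∈ v⁺ θ → p ∈ v⁺ φ × p ∉ P) ×
    (∀ p → p ∈ v⁻ θ → p ∈ v⁻ φ × p ∉ Q) ×
    L (φ ⇒ θ) ×
    (∀ ψ → (∀ p → p ∈ v⁺ ψ → p ∉ P) → (∀ p → p ∈ v⁻ ψ → p ∉ Q) →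
       L (φ ⇒ ψ) → L (θ ⇒ ψ))

-- A derivation in L + X from constant axioms compresses into a single constant premise:
-- if L + X ⊢ φ then L ⊢ c → φ for some constant c with L + X ⊢ c. Constants are fixed by
-- substitution, which lets the substitution rule pass through this normal form, and they
-- contain no variables, so c → ψ obeys the same variable restrictions as ψ. Hence the
-- L-interpolant θ of φ stays uniform in L + X: from L + X ⊢ φ → ψ get L ⊢ φ → (c → ψ),
-- so L ⊢ θ → (c → ψ), and with L + X ⊢ c this gives L + X ⊢ θ → ψ.
module Submission where

open import Defs
open import Data.Nat using (ℕ; zero; suc)
open import Data.Bool using (true; false)
open import Data.List using (List; [])
open import Data.List.Membership.Propositional using (_∈_; _∉_)
open import Data.Product using (_,_)
open import Function using (_∘_)
open import Relation.Binary.PropositionalEquality using (_≡_; refl; subst; cong; cong₂)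

⊤' : Fm
⊤' = ⊥' ⇒ ⊥'

infixr 6 _∧'_

_∧'_ : Fm → Fm → Fm
φ ∧' ψ = (φ ⇒ ψ ⇒ ⊥') ⇒ ⊥'

⊤'-constant : Constant ⊤'
⊤'-constant = c⇒ c⊥ c⊥

∧'-constant : ∀ {φ ψ} → Constant φ → Constant ψ → Constant (φ ∧' ψ)
∧'-constant cφ cψ = c⇒ (c⇒ cφ (c⇒ cψ c⊥)) c⊥

v⁺-constant : ∀ {c} → Constant c → v⁺ c ≡ []
v⁻-constant : ∀ {c} → Constant c → v⁻ c ≡ []
v⁺-constant c⊥ = refl
v⁺-constant (c⇒ cψ cθ) rewrite v⁻-constant cψ | v⁺-constant cθ = refl
v⁺-constant (c□ cψ) = v⁺-constant cψ
v⁻-constant c⊥ = refl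
v⁻-constant (c⇒ cψ cθ) rewrite v⁺-constant cψ | v⁻-constant cθ = refl
v⁻-constant (c□ cψ) = v⁻-constant cψ

sub-constant : ∀ σ {c} → Constant c → sub σ c ≡ c
sub-constant σ c⊥ = refl
sub-constant σ (c⇒ cψ cθ) = cong₂ _⇒_ (sub-constant σ cψ) (sub-constant σ cθ)
sub-constant σ (c□ cψ) = cong □ (sub-constant σ cψ)

v⁺-⇒-constant : ∀ {c} ψ → Constant c → v⁺ (c ⇒ ψ) ≡ v⁺ ψ
v⁺-⇒-constant ψ cc rewrite v⁻-constant cc = refl

v⁻-⇒-constant : ∀ {c} ψ → Constant c → v⁻ (c ⇒ ψ) ≡ v⁻ ψ
v⁻-⇒-constant ψ cc rewrite v⁺-constant cc = refl

id-taut : ∀ φ → Tautology (φ ⇒ φ)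
id-taut φ v b with eval v b φ
... | true = refl
... | false = refl

weaken-taut : ∀ φ ψ → Tautology (φ ⇒ ψ ⇒ φ)
weaken-taut φ ψ v b with eval v b φ | eval v b ψ
... | true | true = refl
... | true | false = refl
... | false | _ = refl

exchange-taut : ∀ φ ψ χ → Tautology ((φ ⇒ ψ ⇒ χ) ⇒ ψ ⇒ φ ⇒ χ)
exchange-taut φ ψ χ v b with eval v b φ | eval v b ψ | eval v b χ
... | true | true | true = refl
... | true | true | false = refl
... | true | false | _ = refl
... | false | true | _ = refl
... | false | false | _ = refl

∧'-intro-taut : ∀ φ ψ → Tautology (φ ⇒ ψ ⇒ φ ∧' ψ)
∧'-intro-taut φ ψ v b with eval v b φ | eval v b ψ
... | true | true = refl
... | true | false = refl
... | false | _ = refl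

∧'-mp-taut : ∀ c d φ ψ → Tautology ((c ⇒ φ ⇒ ψ) ⇒ (d ⇒ φ) ⇒ c ∧' d ⇒ ψ)
∧'-mp-taut c d φ ψ v b with eval v b c | eval v b d | eval v b φ | eval v b ψ
... | true | true | true | true = refl
... | true | true | true | false = refl
... | true | true | false | _ = refl
... | true | false | true | true = refl
... | true | false | true | false = refl
... | true | false | false | _ = refl
... | false | true | true | true = refl
... | false | false | true | true = refl
... | false | true | true | false = refl
... | false | false | true | false = refl
... | false | true | false | _ = refl
... | false | false | false | _ = refl

module NormalLogic {L : Logic} (N : Normal L) where
  open Normal N renaming (taut to L-taut; K to L-K; MP to L-MP; Nec to L-Nec; US to L-US)

  taut-mp : ∀ {φ ψ} → Tautology (φ ⇒ ψ) → L φ → L ψ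
  taut-mp {φ} {ψ} t = L-MP φ ψ (L-taut (φ ⇒ ψ) t)

  taut-mp₂ : ∀ {φ ψ χ} → Tautology (φ ⇒ ψ ⇒ χ) → L φ → L ψ → L χ
  taut-mp₂ {φ} {ψ} {χ} t lφ = L-MP ψ χ (taut-mp t lφ)

  □-mono : ∀ {φ ψ} → L (φ ⇒ ψ) → L (□ φ ⇒ □ ψ)
  □-mono {φ} {ψ} lφψ = L-MP (□ (φ ⇒ ψ)) (□ φ ⇒ □ ψ) (L-US σ Kax L-K) (L-Nec (φ ⇒ ψ) lφψ)
    where
    σ : ℕ → Fm
    σ zero = φ
    σ (suc zero) = ψ
    σ (suc (suc n)) = var n

⊕-normal : ∀ {L X} → Normal (L ⊕ X)
⊕-normal = record
  { taut = λ _ → taut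
  ; K = K
  ; MP = λ _ _ → MP
  ; Nec = λ _ → Nec
  ; US = λ σ _ → US σ
  }

Uniform : Logic → List ℕ → List ℕ → Fm → Fm → Set
Uniform L P Q φ θ =
  ∀ ψ → (∀ p → p ∈ v⁺ ψ → p ∉ P) → (∀ p → p ∈ v⁻ ψ → p ∉ Q) → L (φ ⇒ ψ) → L (θ ⇒ ψ)

record ConstantPremise (L X : Logic) (φ : Fm) : Set where
  field
    premise : Fm
    premise-constant : Constant premise
    premise-derivable : (L ⊕ X) premise
    premise⇒φ : L (premise ⇒ φ)

module _ {L X : Logic} (N : Normal L) (X-constant : ∀ φ → X φ → Constant φ) where
  open NormalLogic N
  open NormalLogic (⊕-normal {L} {X}) using () renaming (taut-mp₂ to ⊕-taut-mp₂)
  open Normal N using () renaming (taut to L-taut; K to L-K; US to L-US)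

  ⊤'-premise : ∀ {φ} → L φ → ConstantPremise L X φ
  ⊤'-premise {φ} lφ = record
    { premise = ⊤'
    ; premise-constant = ⊤'-constant
    ; premise-derivable = taut (λ _ _ → refl)
    ; premise⇒φ = taut-mp (weaken-taut φ ⊤') lφ
    }

  constant-premise : ∀ {φ} → (L ⊕ X) φ → ConstantPremise L X φ
  constant-premise (inL lφ) = ⊤'-premise lφ
  constant-premise {φ} (inX xφ) = record
    { premise = φ
    ; premise-constant = X-constant φ xφ
    ; premise-derivable = inX xφ
    ; premise⇒φ = L-taut _ (id-taut φ)
    }
  constant-premise (taut t) = ⊤'-premise (L-taut _ t)
  constant-premise K = ⊤'-premise L-K
  constant-premise (MP {φ} {ψ} dφψ dφ) = record
    { premise = c ∧' d
    ; premise-constant = ∧'-constant cc cd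
    ; premise-derivable = ⊕-taut-mp₂ (∧'-intro-taut c d) xc xd
    ; premise⇒φ = taut-mp₂ (∧'-mp-taut c d φ ψ) lc ld
    }
    where
    open ConstantPremise (constant-premise dφψ) renaming
      (premise to c; premise-constant to cc; premise-derivable to xc; premise⇒φ to lc)
    open ConstantPremise (constant-premise dφ) renaming
      (premise to d; premise-constant to cd; premise-derivable to xd; premise⇒φ to ld)
  constant-premise (Nec dφ) = record
    { premise = □ premise
    ; premise-constant = c□ premise-constant
    ; premise-derivable = Nec premise-derivable
    ; premise⇒φ = □-mono premise⇒φ
    }
    where open ConstantPremise (constant-premise dφ)
  constant-premise (US {φ} σ dφ) = record
    { premise = premise
    ; premise-constant = premise-constant
    ; premise-derivable = premise-derivable
    ; premise⇒φ = subst (λ c → L (c ⇒ sub σ φ)) (sub-constant σ premise-constant)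
                        (L-US σ _ premise⇒φ)
    }
    where open ConstantPremise (constant-premise dφ)

  Uniform-⊕ : ∀ {P Q φ θ} → Uniform L P Q φ θ → Uniform (L ⊕ X) P Q φ θ
  Uniform-⊕ {P} {Q} {φ} {θ} θ-uniform ψ ψ⁺ ψ⁻ dφψ =
    ⊕-taut-mp₂ (exchange-taut θ c ψ) (inL (θ-uniform (c ⇒ ψ) cψ⁺ cψ⁻ lφcψ)) xc
    where
    open ConstantPremise (constant-premise dφψ) renaming
      (premise to c; premise-constant to cc; premise-derivable to xc; premise⇒φ to lc)
    lφcψ : L (φ ⇒ c ⇒ ψ)
    lφcψ = taut-mp (exchange-taut c φ ψ) lc
    cψ⁺ : ∀ p → p ∈ v⁺ (c ⇒ ψ) → p ∉ P
    cψ⁺ p = ψ⁺ p ∘ subst (p ∈_) (v⁺-⇒-constant ψ cc)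
    cψ⁻ : ∀ p → p ∈ v⁻ (c ⇒ ψ) → p ∉ Q
    cψ⁻ p = ψ⁻ p ∘ subst (p ∈_) (v⁻-⇒-constant ψ cc)

proposition2p15 : (L X : Logic) → Normal L → (∀ φ → X φ → Constant φ) →
                    ULIP L → ULIP (L ⊕ X)
proposition2p15 L X N X-constant ulip φ P Q with ulip φ P Q
... | θ , θ⁺ , θ⁻ , φ⇒θ , θ-uniform =
  θ , θ⁺ , θ⁻ , inL φ⇒θ , Uniform-⊕ N X-constant θ-uniform
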